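{- For every integer $m\ge1$, the coefficient of each term $w$ of $X\cdot P^m\cdot X\in B^{\otimes(m+1)}$ equals $2^{\#_Z(w)}$, where $\#_Z(w)$ is the number of occurrences of the letter $Z$ in $w$.
   Context: Let $\mathcal M=\mathbb Z\langle y,n\rangle/(yn=ny=n,\ n^2=0,\ y^2=y)$. In the ring $\mathcal M\otimes\mathcal M$ (tensor over $\mathbb Z$, with $(a\otimes b)(c\otimes d)=ac\otimes bd$) put $X=y\otimes n+n\otimes y$, $Y=y\otimes y$, $Z=n\otimes n$, and let $B$ be the $\mathbb Z$-span of $X,Y,Z$: a commutative subring, free abelian with basis $X,Y,Z$, with $X^2=2Z$, $Y^2=Y$, $Z^2=0$, $XY=YX=X$, $XZ=ZX=0$, $YZ=ZY=Z$. For $r\ge1$, $B^{\otimes r}$ is free abelian with basis the words $w_1\otimes\cdots\otimes w_r$, $w_i\in\{X,Y,Z\}$; writing $u\in B^{\otimes r}$ uniquely as $\sum_w c_w w$, a term of $u$ is a word $w$ with $c_w\ne0$, and $c_w$ is its coefficient. The chaining product $B^{\otimes r}\times B^{\otimes s}\to B^{\otimes(r+s-1)}$ is the bilinear (associative) map $(a_1\otimes\cdots\otimes a_r)\cdot(b_1\otimes\cdots\otimes b_s)=a_1\otimes\cdots\otimes a_{r-1}\otimes(a_rb_1)\otimes b_2\otimes\cdots\otimes b_s$. Elements of $B$ are regarded as elements of $B^{\otimes1}$. Let $P=X\otimes Y+Y\otimes X\in B^{\otimes2}$ and let $P^m\in B^{\otimes(m+1)}$ be its $m$-fold chaining product. 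-}

module Defs where

open import Data.Nat using (ℕ; zero; suc; _+_)
open import Data.Integer using (ℤ; +_; _*_) renaming (_+_ to _+ℤ_)
open import Data.Vec using (Vec; []; _∷_; _∷ʳ_; splitAt)
open import Data.Product using (_,_)

data Letter : Set where
  X Y Z : Letter

-- Structure constants of B: mul a b c = coefficient of c in the product a·b.
-- X² = 2Z, Y² = Y, Z² = 0, XY = YX = X, XZ = ZX = 0, YZ = ZY = Z.
mul : Letter → Letter → Letter → ℤ
mul X X Z = + 2
mul Y Y Y = + 1
mul X Y X = + 1
mul Y X X = + 1
mul Y Z Z = + 1
mul Z Y Z = + 1
mul _ _ _ = + 0

-- B^{⊗r}: free abelian group with basis the words of length r; an element u
-- is represented by its coefficient function w ↦ c_w (the basis is finite,
-- so this is exactly the free Z-module).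
Tensor : ℕ → Set
Tensor r = Vec Letter r → ℤ

ΣL : (Letter → ℤ) → ℤ
ΣL f = f X +ℤ (f Y +ℤ f Z)

δL : Letter → Letter → ℤ
δL X X = + 1
δL Y Y = + 1
δL Z Z = + 1
δL _ _ = + 0

letter : Letter → Tensor 1
letter a (b ∷ []) = δL a b

letter2 : Letter → Letter → Tensor 2
letter2 a b (c ∷ d ∷ []) = δL a c * δL b d

_⊕_ : ∀ {r} → Tensor r → Tensor r → Tensor r
(u ⊕ v) w = u w +ℤ v w

-- Chaining product B^{⊗(r+1)} × B^{⊗(s+1)} → B^{⊗(r+s+1)} (bilinear):
-- coefficient of a₁…a_r c b₁…b_s is Σ_{x,y} u(a₁…a_r x) · v(y b₁…b_s) · [c in x·y].
chain : ∀ {r s} → Tensor (suc r) → Tensor (suc s) → Tensor (r + suc s)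
chain {r} {s} u v w with splitAt r w
... | a , (c ∷ b) , _ = ΣL λ x → ΣL λ y → u (a ∷ʳ x) * (v (y ∷ b) * mul x y c)

P : Tensor 2
P = letter2 X Y ⊕ letter2 Y X

-- P^m ∈ B^{⊗(m+1)}, the m-fold chaining product (P^1 = P, P^{m+1} = P·P^m;
-- the m = 0 value is the unit Y of B and is irrelevant to the statement).
Ppow : (m : ℕ) → Tensor (suc m)
Ppow zero = letter Y
Ppow (suc zero) = P
Ppow (suc (suc m)) = chain P (Ppow (suc m))

XPX : (m : ℕ) → Tensor (m + 1)
XPX m = chain {m} {0} (chain {0} {m} (letter X) (Ppow m)) (letter X)

#Z : ∀ {r} → Vec Letter r → ℕ
#Z [] = 0
#Z (Z ∷ w) = suc (#Z w)
#Z (_ ∷ w) = #Z w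

{-# OPTIONS --safe #-}
-- Chaining P = X⊗Y + Y⊗X onto a letter a gives the recurrence
--   a·P^(m+1)·X = aX ⊗ (Y·P^m·X) + aY ⊗ (X·P^m·X).
-- For a ∈ {X, Y} the products aX and aY are distinct elements of {X, Y, 2Z}, so a coefficient of
-- a·P^(m+1)·X is 0 or a coefficient of X·P^m·X or Y·P^m·X, doubled exactly when the word starts
-- with Z (from X² = 2Z). Induction on m from a·P⁰·X = a·Y·X ∈ {2Z, X} gives 0 or 2^#Z.
module Submission where

open import Defs
open import Data.Nat using (ℕ; _≤_; _+_; _^_; zero; suc)
open import Data.Integer using (ℤ; +_; _*_) renaming (_+_ to _+ℤ_)
open import Data.Integer.Properties using (+-identityʳ; +-identityˡ; *-identityˡ; *-comm; pos-*)
open import Data.Integer.Tactic.RingSolver using (solve-∀)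
open import Data.Vec using (Vec; []; _∷_; _∷ʳ_; splitAt)
open import Data.Product using (_,_)
open import Data.Sum using (_⊎_; inj₁; inj₂)
open import Relation.Nullary using (contradiction)
open import Relation.Binary.PropositionalEquality
  using (_≡_; _≢_; _≗_; refl; sym; trans; cong; cong₂; subst; module ≡-Reasoning)

open ≡-Reasoning

ΣL-cong : ∀ {f g : Letter → ℤ} → f ≗ g → ΣL f ≡ ΣL g
ΣL-cong f≗g = cong₂ _+ℤ_ (f≗g X) (cong₂ _+ℤ_ (f≗g Y) (f≗g Z))

ΣL-scale : ∀ k (f : Letter → ℤ) → ΣL (λ x → k * f x) ≡ k * ΣL f
ΣL-scale k f = identity k (f X) (f Y) (f Z)
  where
  identity : ∀ k a b c → k * a +ℤ (k * b +ℤ k * c) ≡ k * (a +ℤ (b +ℤ c))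
  identity = solve-∀

ΣL-linear : ∀ α β (f g : Letter → ℤ) →
  ΣL (λ x → α * f x +ℤ β * g x) ≡ α * ΣL f +ℤ β * ΣL g
ΣL-linear α β f g = identity α β (f X) (f Y) (f Z) (g X) (g Y) (g Z)
  where
  identity : ∀ α β f₁ f₂ f₃ g₁ g₂ g₃ →
    (α * f₁ +ℤ β * g₁) +ℤ ((α * f₂ +ℤ β * g₂) +ℤ (α * f₃ +ℤ β * g₃))
    ≡ α * (f₁ +ℤ (f₂ +ℤ f₃)) +ℤ β * (g₁ +ℤ (g₂ +ℤ g₃))
  identity = solve-∀

ΣL-δ : ∀ a (f : Letter → ℤ) → ΣL (λ x → δL a x * f x) ≡ f a
ΣL-δ X f = trans (+-identityʳ (+ 1 * f X)) (*-identityˡ (f X))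
ΣL-δ Y f = trans (+-identityˡ (+ 1 * f Y +ℤ + 0)) (trans (+-identityʳ (+ 1 * f Y)) (*-identityˡ (f Y)))
ΣL-δ Z f = trans (+-identityˡ (+ 0 +ℤ + 1 * f Z)) (trans (+-identityˡ (+ 1 * f Z)) (*-identityˡ (f Z)))

mul-identityʳ : ∀ x c → mul x Y c ≡ δL c x
mul-identityʳ X X = refl
mul-identityʳ X Y = refl
mul-identityʳ X Z = refl
mul-identityʳ Y X = refl
mul-identityʳ Y Y = refl
mul-identityʳ Y Z = refl
mul-identityʳ Z X = refl
mul-identityʳ Z Y = refl
mul-identityʳ Z Z = refl

chain-∷ : ∀ {r s} (u : Tensor (suc (suc r))) (v : Tensor (suc s)) c w →
  chain {suc r} {s} u v (c ∷ w) ≡ chain {r} {s} (λ t → u (c ∷ t)) v w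
chain-∷ {r} u v c w with splitAt r w
... | _ , (_ ∷ _) , _ = refl

chain-congˡ : ∀ {r s} {u u′ : Tensor (suc r)} (v : Tensor (suc s)) →
  u ≗ u′ → chain {r} {s} u v ≗ chain {r} {s} u′ v
chain-congˡ {r} v u≗u′ w with splitAt r w
... | a , (c ∷ b) , _ =
  ΣL-cong (λ x → ΣL-cong (λ y → cong (_* (v (y ∷ b) * mul x y c)) (u≗u′ (a ∷ʳ x))))

chain-congʳ : ∀ {r s} (u : Tensor (suc r)) {v v′ : Tensor (suc s)} →
  v ≗ v′ → chain {r} {s} u v ≗ chain {r} {s} u v′
chain-congʳ {r} u v≗v′ w with splitAt r w
... | a , (c ∷ b) , _ =
  ΣL-cong (λ x → ΣL-cong (λ y → cong (λ z → u (a ∷ʳ x) * (z * mul x y c)) (v≗v′ (y ∷ b))))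

chain-linearˡ : ∀ {r s} α β (f g : Tensor (suc r)) (v : Tensor (suc s)) w →
  chain {r} {s} (λ t → α * f t +ℤ β * g t) v w
  ≡ α * chain {r} {s} f v w +ℤ β * chain {r} {s} g v w
chain-linearˡ {r} α β f g v w with splitAt r w
... | a , (c ∷ b) , _ = begin
    ΣL (λ x → ΣL (λ y → (α * f (a ∷ʳ x) +ℤ β * g (a ∷ʳ x)) * k x y))
  ≡⟨ ΣL-cong (λ x → trans (ΣL-cong (λ y → distrib α β (f (a ∷ʳ x)) (g (a ∷ʳ x)) (k x y)))
                          (ΣL-linear α β (λ y → f (a ∷ʳ x) * k x y) (λ y → g (a ∷ʳ x) * k x y))) ⟩
    ΣL (λ x → α * ΣL (λ y → f (a ∷ʳ x) * k x y) +ℤ β * ΣL (λ y → g (a ∷ʳ x) * k x y))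
  ≡⟨ ΣL-linear α β (λ x → ΣL (λ y → f (a ∷ʳ x) * k x y)) (λ x → ΣL (λ y → g (a ∷ʳ x) * k x y)) ⟩
    α * ΣL (λ x → ΣL (λ y → f (a ∷ʳ x) * k x y)) +ℤ β * ΣL (λ x → ΣL (λ y → g (a ∷ʳ x) * k x y))
  ∎
  where
  k : Letter → Letter → ℤ
  k x y = v (y ∷ b) * mul x y c
  distrib : ∀ α β p q z → (α * p +ℤ β * q) * z ≡ α * (p * z) +ℤ β * (q * z)
  distrib = solve-∀

chain-identityʳ : (u : Tensor 1) → chain {0} {0} u (letter Y) ≗ u
chain-identityʳ u (c ∷ []) = begin
    ΣL (λ x → ΣL (λ y → u (x ∷ []) * (δL Y y * mul x y c)))
  ≡⟨ ΣL-cong (λ x → ΣL-scale (u (x ∷ [])) (λ y → δL Y y * mul x y c)) ⟩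
    ΣL (λ x → u (x ∷ []) * ΣL (λ y → δL Y y * mul x y c))
  ≡⟨ ΣL-cong (λ x → cong (u (x ∷ []) *_) (trans (ΣL-δ Y (λ y → mul x y c)) (mul-identityʳ x c))) ⟩
    ΣL (λ x → u (x ∷ []) * δL c x)
  ≡⟨ ΣL-cong (λ x → *-comm (u (x ∷ [])) (δL c x)) ⟩
    ΣL (λ x → δL c x * u (x ∷ []))
  ≡⟨ ΣL-δ c (λ x → u (x ∷ [])) ⟩
    u (c ∷ [])
  ∎

Ppow-suc : ∀ m → Ppow (suc m) ≗ chain P (Ppow m)
Ppow-suc zero    (c ∷ w) =
  sym (trans (chain-∷ P (letter Y) c w) (chain-identityʳ (λ t → P (c ∷ t)) w))
Ppow-suc (suc m) w       = refl

letter-chain-P : ∀ {m} a (v : Tensor (suc m)) c c′ b →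
  chain {0} (letter a) (chain P v) (c ∷ c′ ∷ b)
  ≡ mul a X c * chain {0} (letter Y) v (c′ ∷ b) +ℤ mul a Y c * chain {0} (letter X) v (c′ ∷ b)
letter-chain-P {m} a v c c′ b = begin
    ΣL (λ x → ΣL (λ y → δL a x * (Pv (y ∷ c′ ∷ b) * mul x y c)))
  ≡⟨ ΣL-cong (λ x → ΣL-scale (δL a x) (λ y → Pv (y ∷ c′ ∷ b) * mul x y c)) ⟩
    ΣL (λ x → δL a x * ΣL (λ y → Pv (y ∷ c′ ∷ b) * mul x y c))
  ≡⟨ ΣL-δ a (λ x → ΣL (λ y → Pv (y ∷ c′ ∷ b) * mul x y c)) ⟩
    ΣL (λ y → Pv (y ∷ c′ ∷ b) * mul a y c)
  ≡⟨ rearrange (Yv (c′ ∷ b)) (Xv (c′ ∷ b)) (mul a X c) (mul a Y c) ⟩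
    mul a X c * Yv (c′ ∷ b) +ℤ mul a Y c * Xv (c′ ∷ b)
  ∎
  where
  Pv : Tensor (suc (suc m))
  Pv = chain P v
  Yv Xv : Tensor (suc m)
  Yv = chain {0} (letter Y) v
  Xv = chain {0} (letter X) v
  -- The rows of P·v are computed by normalisation: Pv (X ∷ t) = Yv t, Pv (Y ∷ t) = Xv t
  -- and Pv (Z ∷ t) = 0, since P = X⊗Y + Y⊗X.
  rearrange : ∀ p q α β → p * α +ℤ (q * β +ℤ + 0) ≡ α * p +ℤ β * q
  rearrange = solve-∀

_·P^_·X : Letter → (m : ℕ) → Tensor (m + 1)
a ·P^ m ·X = chain {m} {0} (chain {0} {m} (letter a) (Ppow m)) (letter X)

·P^·X-step : ∀ a m c t →
  (a ·P^ suc m ·X) (c ∷ t) ≡ mul a X c * (Y ·P^ m ·X) t +ℤ mul a Y c * (X ·P^ m ·X) t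
·P^·X-step a m c t = begin
    (a ·P^ suc m ·X) (c ∷ t)
  ≡⟨ chain-∷ aP (letter X) c t ⟩
    chain (λ t′ → aP (c ∷ t′)) (letter X) t
  ≡⟨ chain-congˡ (letter X) expand t ⟩
    chain (λ t′ → mul a X c * YP t′ +ℤ mul a Y c * XP t′) (letter X) t
  ≡⟨ chain-linearˡ (mul a X c) (mul a Y c) YP XP (letter X) t ⟩
    mul a X c * (Y ·P^ m ·X) t +ℤ mul a Y c * (X ·P^ m ·X) t
  ∎
  where
  aP : Tensor (suc (suc m))
  aP = chain {0} (letter a) (Ppow (suc m))
  YP XP : Tensor (suc m)
  YP = chain {0} (letter Y) (Ppow m)
  XP = chain {0} (letter X) (Ppow m)
  expand : ∀ t′ → aP (c ∷ t′) ≡ mul a X c * YP t′ +ℤ mul a Y c * XP t′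
  expand (c′ ∷ b) =
    trans (chain-congʳ (letter a) (Ppow-suc m) (c ∷ c′ ∷ b)) (letter-chain-P a (Ppow m) c c′ b)

ZeroOr2^ : ℤ → ℕ → Set
ZeroOr2^ e n = e ≡ + 0 ⊎ e ≡ + (2 ^ n)

ZeroOr2^-resp : ∀ {e f} n → e ≡ f → ZeroOr2^ f n → ZeroOr2^ e n
ZeroOr2^-resp n e≡f = subst (λ g → ZeroOr2^ g n) (sym e≡f)

ZeroOr2^-double : ∀ {e} n → ZeroOr2^ e n → ZeroOr2^ (+ 2 * e) (suc n)
ZeroOr2^-double n (inj₁ refl) = inj₁ refl
ZeroOr2^-double n (inj₂ refl) = inj₂ (sym (pos-* 2 (2 ^ n)))

data IsXY : Letter → Set where
  isX : IsXY X
  isY : IsXY Y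

·P^·X-coeff : ∀ m {a} → IsXY a → ∀ w → ZeroOr2^ ((a ·P^ m ·X) w) (#Z w)
·P^·X-coeff zero isX (X ∷ []) = inj₁ refl
·P^·X-coeff zero isX (Y ∷ []) = inj₁ refl
·P^·X-coeff zero isX (Z ∷ []) = inj₂ refl
·P^·X-coeff zero isY (X ∷ []) = inj₂ refl
·P^·X-coeff zero isY (Y ∷ []) = inj₁ refl
·P^·X-coeff zero isY (Z ∷ []) = inj₁ refl
·P^·X-coeff (suc m) isX (X ∷ t) =
  ZeroOr2^-resp (#Z t) (trans (·P^·X-step X m X t) (trans (+-identityˡ _) (*-identityˡ _)))
    (·P^·X-coeff m isX t)
·P^·X-coeff (suc m) isX (Y ∷ t) = inj₁ (·P^·X-step X m Y t)
·P^·X-coeff (suc m) isX (Z ∷ t) =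
  ZeroOr2^-resp (#Z (Z ∷ t)) (trans (·P^·X-step X m Z t) (+-identityʳ _))
    (ZeroOr2^-double (#Z t) (·P^·X-coeff m isY t))
·P^·X-coeff (suc m) isY (X ∷ t) =
  ZeroOr2^-resp (#Z t) (trans (·P^·X-step Y m X t) (trans (+-identityʳ _) (*-identityˡ _)))
    (·P^·X-coeff m isY t)
·P^·X-coeff (suc m) isY (Y ∷ t) =
  ZeroOr2^-resp (#Z t) (trans (·P^·X-step Y m Y t) (trans (+-identityˡ _) (*-identityˡ _)))
    (·P^·X-coeff m isX t)
·P^·X-coeff (suc m) isY (Z ∷ t) = inj₁ (·P^·X-step Y m Z t)

lemma4p7 : (m : ℕ) → 1 ≤ m → (w : Vec Letter (m + 1)) →
               XPX m w ≢ + 0 → XPX m w ≡ + (2 ^ #Z w)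
lemma4p7 m _ w XPX≢0 with ·P^·X-coeff m isX w
... | inj₁ XPX≡0   = contradiction XPX≡0 XPX≢0
... | inj₂ XPX≡2^n = XPX≡2^n
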